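{- Let $r,k\geq 3$ be integers. Then $0\in D_{r,k}$, and if $d,d'\in D_{r,k}$ then $d+d'\in D_{r,k}$.
   Context: For positive integers $v,b,r,k$, a $(v,b,r,k)$-configuration is a connected bipartite graph with $v$ vertices on one side, each of degree $r$, and $b$ vertices on the other side, each of degree $k$, containing no cycle of length $4$. A tuple $(v,b,r,k)$ is configurable if such a configuration exists; by convention the empty graph is also regarded as a configuration, so the tuple with $v=b=0$ is configurable. For positive integers $r,k$ define $$D_{r,k}=\Big\{d\in\mathbb{N}_0 : \Big(d\tfrac{k}{\gcd(r,k)},\, d\tfrac{r}{\gcd(r,k)},\, r,\, k\Big)\text{ is configurable}\Big\}.$$ -}

module Defs where

open import Data.Nat using (ℕ; zero; suc; _+_; _*_)
open import Data.Nat.DivMod using (_/_)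
open import Data.Nat.GCD using (gcd)
open import Data.Bool using (Bool; true; false; if_then_else_)
open import Data.Fin using (Fin)
import Data.Fin as Fin
open import Data.Sum using (_⊎_; inj₁; inj₂)
open import Data.Product using (_×_; Σ)
open import Relation.Binary.PropositionalEquality using (_≡_; _≢_)
open import Relation.Binary.Construct.Closure.ReflexiveTransitive using (Star)

count : (n : ℕ) → (Fin n → Bool) → ℕ
count zero    f = 0
count (suc n) f = (if f Fin.zero then 1 else 0) + count n (λ i → f (Fin.suc i))

-- A bipartite graph with v "point" vertices and b "block" vertices,
-- given by its (Boolean) adjacency between the two sides.
Incidence : ℕ → ℕ → Set
Incidence v b = Fin v → Fin b → Bool

Vertex : ℕ → ℕ → Set
Vertex v b = Fin v ⊎ Fin b

Adj : ∀ {v b} → Incidence v b → Vertex v b → Vertex v b → Set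
Adj I (inj₁ p) (inj₂ B) = I p B ≡ true
Adj I (inj₂ B) (inj₁ p) = I p B ≡ true
Adj I (inj₁ _) (inj₁ _) = Data.Empty.⊥ where import Data.Empty
Adj I (inj₂ _) (inj₂ _) = Data.Empty.⊥ where import Data.Empty

-- connected: any two vertices are joined by a walk (empty graph is vacuously connected)
Connected : ∀ {v b} → Incidence v b → Set
Connected {v} {b} I = (x y : Vertex v b) → Star (Adj I) x y

NoC4 : ∀ {v b} → Incidence v b → Set
NoC4 {v} {b} I = (p p' : Fin v) (B B' : Fin b) → p ≢ p' → B ≢ B' →
  I p B ≡ true → I p B' ≡ true → I p' B ≡ true → I p' B' ≡ true → Data.Empty.⊥
  where import Data.Empty

IsConfiguration : (v b r k : ℕ) → Incidence v b → Set
IsConfiguration v b r k I =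
  Connected I × NoC4 I ×
  ((p : Fin v) → count b (I p) ≡ r) ×
  ((B : Fin b) → count v (λ p → I p B) ≡ k)

Configurable : (v b r k : ℕ) → Set
Configurable v b r k = Σ (Incidence v b) (IsConfiguration v b r k)

-- m divided by n, with the (irrelevant here) convention m / 0 = 0
_div_ : ℕ → ℕ → ℕ
m div zero  = 0
m div suc n = m / suc n

InD : (r k d : ℕ) → Set
InD r k d = Configurable (d * (k div gcd r k)) (d * (r div gcd r k)) r k

-- The empty graph gives 0 ∈ D. For closure under addition, put a (v₁,b₁,r,k)- and a
-- (v₂,b₂,r,k)-configuration side by side, pick an edge p₁B₁ of the first that lies on a
-- cycle and any edge p₂B₂ of the second, and replace these two edges by p₁B₂ and p₂B₁.
-- All degrees are unchanged; a 4-cycle would have to use both new edges, and hence both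
-- deleted ones; and the result is connected because p₁ and B₁ stay joined inside the
-- first half. An edge on a cycle exists because all degrees are at least 2: a
-- degree≥2⇒turn walk must revisit a vertex, and its first revisit closes a cycle.
module Submission where

open import Defs
open import Data.Bool using (Bool; true; false; _∧_; not; if_then_else_)
import Data.Bool.Properties as Bool
open import Data.Empty using (⊥; ⊥-elim)
open import Data.Fin using (Fin; splitAt; join; toℕ; _≟_)
import Data.Fin as Fin
open import Data.Fin.Properties using (any?; pigeonhole; splitAt-join; join-splitAt; suc-injective)
open import Data.Nat using (ℕ; zero; suc; _+_; _≤_; _<_; _≤′_; ≤′-reflexive; ≤′-step; z≤n; s≤s)
open import Data.Nat.GCD using (gcd)
open import Data.Nat.Induction using (<-wellFounded)
open import Data.Nat.Properties
  using (+-assoc; +-comm; +-suc; +-identityʳ; *-distribʳ-+; ≤-refl; ≤-trans; <⇒≱; n<1+n; n≤1+n;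
         m<n⇒m<1+n; m≤n⇒m<n∨m≡n; anyUpTo?; ≤⇒≤′; ≤′⇒≤)
open import Data.Product using (_×_; _,_; proj₁; proj₂; ∃; ∃₂)
open import Data.Sum using (_⊎_; inj₁; inj₂)
import Data.Sum as Sum
import Data.Sum.Properties as Sum
open import Function using (_∘_)
open import Induction.WellFounded using (Acc; acc)
open import Level using (0ℓ)
open import Relation.Binary using (Rel; DecidableEquality)
open import Relation.Binary.Construct.Closure.ReflexiveTransitive using (Star; ε; _◅_; _◅◅_)
import Relation.Binary.Construct.Closure.ReflexiveTransitive as Star
open import Relation.Binary.PropositionalEquality
open import Relation.Nullary using (¬_; Dec; yes; no; does; ¬?; _×-dec_)
open import Relation.Nullary.Decidable using (dec-true)
open import Relation.Unary using (Pred; Decidable)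

least-witness : ∀ {p} {P : Pred ℕ p} → Decidable P → ∀ {n} → P n →
                ∃ λ m → P m × (∀ {k} → k < m → ¬ P k)
least-witness {P = P} P? Pn = go (<-wellFounded _) Pn
  where
  go : ∀ {n} → Acc _<_ n → P n → ∃ λ m → P m × (∀ {k} → k < m → ¬ P k)
  go {n} (acc below) Pn with anyUpTo? P? n
  ... | yes (k , k<n , Pk) = go (below k<n) Pk
  ... | no  none           = n , Pn , λ k<n Pk → none (_ , k<n , Pk)

star-along : ∀ {ℓ} {V : Set} {R : Rel V ℓ} (w : ℕ → V) {s t} → s ≤ t →
             (∀ {u} → s ≤ u → u < t → R (w u) (w (suc u))) → Star R (w s) (w t)
star-along {R = R} w s≤t = go (≤⇒≤′ s≤t)
  where
  go : ∀ {s t} → s ≤′ t → (∀ {u} → s ≤ u → u < t → R (w u) (w (suc u))) → Star R (w s) (w t)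
  go (≤′-reflexive refl) _    = ε
  go (≤′-step s≤′t)      step =
    go s≤′t (λ s≤u u<t → step s≤u (m<n⇒m<1+n u<t)) ◅◅ (step (≤′⇒≤ s≤′t) ≤-refl ◅ ε)

splitAt-injective : ∀ m {n} {i j : Fin (m + n)} → splitAt m i ≡ splitAt m j → i ≡ j
splitAt-injective m {n} {i} {j} eq =
  trans (sym (join-splitAt m n i)) (trans (cong (join m n) eq) (join-splitAt m n j))

join-injective : ∀ m n {x y : Fin m ⊎ Fin n} → join m n x ≡ join m n y → x ≡ y
join-injective m n {x} {y} eq =
  trans (sym (splitAt-join m n x)) (trans (cong (splitAt m) eq) (splitAt-join m n y))

count-cong : ∀ n {f g : Fin n → Bool} → (∀ x → f x ≡ g x) → count n f ≡ count n g
count-cong zero    f≗g = refl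
count-cong (suc n) f≗g =
  cong₂ _+_ (cong (λ t → if t then 1 else 0) (f≗g Fin.zero)) (count-cong n (f≗g ∘ Fin.suc))

count-false : ∀ n {f : Fin n → Bool} → (∀ x → f x ≡ false) → count n f ≡ 0
count-false zero    _         = refl
count-false (suc n) f≗false rewrite f≗false Fin.zero = count-false n (f≗false ∘ Fin.suc)

count-point : ∀ n {f g : Fin n → Bool} (e : Fin n) → f e ≡ true → g e ≡ false →
              (∀ x → x ≢ e → f x ≡ g x) → count n f ≡ suc (count n g)
count-point (suc n) Fin.zero fe ge f≗g rewrite fe | ge =
  cong suc (count-cong n (λ x → f≗g (Fin.suc x) λ ()))
count-point (suc n) (Fin.suc e) fe ge f≗g rewrite f≗g Fin.zero (λ ()) =
  trans (cong (_ +_) (count-point n e fe ge (λ x x≢e → f≗g (Fin.suc x) (x≢e ∘ suc-injective))))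
        (+-suc _ _)

count-single : ∀ n {f : Fin n → Bool} (e : Fin n) → f e ≡ true →
               (∀ x → x ≢ e → f x ≡ false) → count n f ≡ 1
count-single n e fe off = trans (count-point n e fe refl off) (cong suc (count-false n λ _ → refl))

count-≤1 : ∀ n {f : Fin n → Bool} (e : Fin n) → (∀ x → x ≢ e → f x ≡ false) → count n f ≤ 1
count-≤1 (suc n) {f} Fin.zero off
  rewrite count-false n (λ x → off (Fin.suc x) λ ()) | +-identityʳ (if f Fin.zero then 1 else 0)
  with f Fin.zero
... | true  = ≤-refl
... | false = z≤n
count-≤1 (suc n) (Fin.suc e) off rewrite off Fin.zero (λ ()) =
  count-≤1 n e (λ x x≢e → off (Fin.suc x) (x≢e ∘ suc-injective))

count>0⇒∃ : ∀ n {f : Fin n → Bool} → 0 < count n f → ∃ λ x → f x ≡ true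
count>0⇒∃ (suc n) {f} pos with f Fin.zero in fzero
... | true  = Fin.zero , fzero
... | false with count>0⇒∃ n pos
...   | x , fx = Fin.suc x , fx

count≥2⇒∃≢ : ∀ n {f : Fin n → Bool} → 2 ≤ count n f → ∀ e → ∃ λ x → x ≢ e × f x ≡ true
count≥2⇒∃≢ n {f} two e with any? (λ x → ¬? (x ≟ e) ×-dec (f x Bool.≟ true))
... | yes found = found
... | no  none  = ⊥-elim (<⇒≱ two (count-≤1 n e λ x x≢e → Bool.¬-not λ fx → none (x , x≢e , fx)))

count-splitAt : ∀ m n (f : Fin m ⊎ Fin n → Bool) →
                count (m + n) (f ∘ splitAt m) ≡ count m (f ∘ inj₁) + count n (f ∘ inj₂)
count-splitAt zero    n f = refl
count-splitAt (suc m) n f =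
  trans (cong ((if f (inj₁ Fin.zero) then 1 else 0) +_) (count-splitAt m n (f ∘ Sum.map₁ Fin.suc)))
        (sym (+-assoc (if f (inj₁ Fin.zero) then 1 else 0) _ _))

private
  variable
    v b v′ b′ : ℕ

_ᵀ : Incidence v b → Incidence b v
(I ᵀ) c a = I a c

opaque
  edge : Fin v → Fin b → Incidence v b
  edge p B a c = does (a ≟ p) ∧ does (c ≟ B)

  edge-self : (p : Fin v) (B : Fin b) → edge p B p B ≡ true
  edge-self p B = cong₂ _∧_ (dec-true (p ≟ p) refl) (dec-true (B ≟ B) refl)

  edge-false : {p a : Fin v} {B c : Fin b} → ¬ (a ≡ p × c ≡ B) → edge p B a c ≡ false
  edge-false {p = p} {a} {B} {c} a,c≢p,B with a ≟ p | c ≟ B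
  ... | yes a≡p | yes c≡B = ⊥-elim (a,c≢p,B (a≡p , c≡B))
  ... | yes _   | no  _   = refl
  ... | no  _   | _       = refl

  edge⇒≡ : {p a : Fin v} {B c : Fin b} → edge p B a c ≡ true → a ≡ p × c ≡ B
  edge⇒≡ {p = p} {a} {B} {c} e with a ≟ p | c ≟ B
  ... | yes a≡p | yes c≡B = a≡p , c≡B
  edge⇒≡ () | yes _ | no _
  edge⇒≡ () | no  _ | _

  edge-ᵀ : (p : Fin v) (B : Fin b) (a : Fin v) (c : Fin b) → edge p B a c ≡ edge B p c a
  edge-ᵀ p B a c = Bool.∧-comm (does (a ≟ p)) (does (c ≟ B))

deleteEdge : Incidence v b → Fin v → Fin b → Incidence v b
deleteEdge I p B a c = I a c ∧ not (edge p B a c)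

deleteEdge-self : (I : Incidence v b) (p : Fin v) (B : Fin b) → deleteEdge I p B p B ≡ false
deleteEdge-self I p B rewrite edge-self p B = Bool.∧-zeroʳ (I p B)

deleteEdge-other : (I : Incidence v b) → ∀ {p a B c} → ¬ (a ≡ p × c ≡ B) →
                   deleteEdge I p B a c ≡ I a c
deleteEdge-other I {a = a} {c = c} a,c≢p,B rewrite edge-false a,c≢p,B = Bool.∧-identityʳ (I a c)

deleteEdge⊆ : (I : Incidence v b) → ∀ {p a B c} → deleteEdge I p B a c ≡ true → I a c ≡ true
deleteEdge⊆ I {a = a} {c = c} e with I a c
deleteEdge⊆ I e  | true  = refl
deleteEdge⊆ I () | false

deleteEdge-removes : (I : Incidence v b) → ∀ {p a B c} → deleteEdge I p B a c ≡ true →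
                     ¬ (a ≡ p × c ≡ B)
deleteEdge-removes I e (refl , refl) with trans (sym e) (deleteEdge-self I _ _)
... | ()

row-after-swap : (I : Incidence v b) {p : Fin v} {B : Fin b} (B′ : Fin b′) → I p B ≡ true →
                 ∀ a → count b (deleteEdge I p B a) + count b′ (edge p B′ a) ≡ count b (I a)
row-after-swap {b = b} {b′ = b′} I {p} {B} B′ pB a = by-cases (a ≟ p)
  where
  open ≡-Reasoning
  by-cases : Dec (a ≡ p) → count b (deleteEdge I p B a) + count b′ (edge p B′ a) ≡ count b (I a)
  by-cases (no a≢p) =
    trans (cong₂ _+_ (count-cong b λ _ → deleteEdge-other I (a≢p ∘ proj₁))
                     (count-false b′ λ c → edge-false {c = c} (a≢p ∘ proj₁)))
          (+-identityʳ _)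
  by-cases (yes refl) = begin
    count b (deleteEdge I p B p) + count b′ (edge p B′ p)
      ≡⟨ cong (_ +_) (count-single b′ B′ (edge-self p B′)
                        λ c c≢B′ → edge-false {a = p} {c = c} (c≢B′ ∘ proj₂)) ⟩
    count b (deleteEdge I p B p) + 1
      ≡⟨ +-comm _ 1 ⟩
    suc (count b (deleteEdge I p B p))
      ≡⟨ count-point b B pB (deleteEdge-self I p B)
                     (λ c c≢B → sym (deleteEdge-other I {a = p} {c = c} (c≢B ∘ proj₂))) ⟨
    count b (I p) ∎

column-after-swap : (I : Incidence v b) {p : Fin v} {B : Fin b} (p′ : Fin v′) → I p B ≡ true →
                    ∀ c → count v (λ a → deleteEdge I p B a c) + count v′ (λ a → edge p′ B a c)
                          ≡ count v (λ a → I a c)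
column-after-swap {v = v} {v′ = v′} I {p} {B} p′ pB c =
  trans (cong₂ _+_ (count-cong v λ a → cong (λ t → I a c ∧ not t) (edge-ᵀ p B a c))
                   (count-cong v′ λ a → edge-ᵀ p′ B a c))
        (row-after-swap (I ᵀ) p′ pB c)

Adj-sym : (I : Incidence v b) {x y : Vertex v b} → Adj I x y → Adj I y x
Adj-sym I {inj₁ _} {inj₂ _} e = e
Adj-sym I {inj₂ _} {inj₁ _} e = e

walk-reverse : (I : Incidence v b) {x y : Vertex v b} → Star (Adj I) x y → Star (Adj I) y x
walk-reverse I = Star.reverse (Adj-sym I)

adj-deleteEdge : (I : Incidence v b) (p : Fin v) (B : Fin b) {x y : Vertex v b} → Adj I x y →
                 Adj (deleteEdge I p B) x y ⊎ (x ≡ inj₁ p ⊎ x ≡ inj₂ B)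
adj-deleteEdge I p B {inj₁ a} {inj₂ c} e with (a ≟ p) ×-dec (c ≟ B)
... | yes (refl , refl) = inj₂ (inj₁ refl)
... | no  a,c≢p,B       = inj₁ (trans (deleteEdge-other I a,c≢p,B) e)
adj-deleteEdge I p B {inj₂ c} {inj₁ a} e with (a ≟ p) ×-dec (c ≟ B)
... | yes (refl , refl) = inj₂ (inj₂ refl)
... | no  a,c≢p,B       = inj₁ (trans (deleteEdge-other I a,c≢p,B) e)

deleteEdge-reaches-end : (I : Incidence v b) (p : Fin v) (B : Fin b) {x : Vertex v b} →
                         Star (Adj I) x (inj₁ p) →
                         Star (Adj (deleteEdge I p B)) x (inj₁ p) ⊎
                         Star (Adj (deleteEdge I p B)) x (inj₂ B)
deleteEdge-reaches-end I p B ε = inj₁ ε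
deleteEdge-reaches-end I p B (e ◅ walk) with adj-deleteEdge I p B e
... | inj₂ (inj₁ refl) = inj₁ ε
... | inj₂ (inj₂ refl) = inj₂ ε
... | inj₁ e′          = Sum.map (e′ ◅_) (e′ ◅_) (deleteEdge-reaches-end I p B walk)

Without : {V : Set} → Rel V 0ℓ → V → V → Rel V 0ℓ
Without R x y u u′ = R u u′ × ¬ (u ≡ x × u′ ≡ y) × ¬ (u ≡ y × u′ ≡ x)

module NonBacktrackingWalk {V : Set} {n : ℕ} (index : V → Fin n)
  (index-injective : ∀ {x y} → index x ≡ index y → x ≡ y) (_≟ᵥ_ : DecidableEquality V)
  (R : Rel V 0ℓ) (turn : ∀ {x y} → R x y → ∃ λ z → R y z × z ≢ x)
  {x₀ y₀ : V} (r₀ : R x₀ y₀) where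

  Step : Set
  Step = ∃₂ R

  advance : Step → Step
  advance (_ , y , r) = y , proj₁ (turn r) , proj₁ (proj₂ (turn r))

  steps : ℕ → Step
  steps zero    = x₀ , y₀ , r₀
  steps (suc t) = advance (steps t)

  w : ℕ → V
  w t = proj₁ (steps t)

  w-step : ∀ t → R (w t) (w (suc t))
  w-step t = proj₂ (proj₂ (steps t))

  w-no-backtrack : ∀ t → w (suc (suc t)) ≢ w t
  w-no-backtrack t = proj₂ (proj₂ (turn (w-step t)))

  Revisits : ℕ → Set
  Revisits j = ∃ λ i → i < j × w i ≡ w j

  revisits? : Decidable Revisits
  revisits? j = anyUpTo? (λ i → w i ≟ᵥ w j) j

  revisit : ∃ Revisits
  revisit with pigeonhole (n<1+n n) (index ∘ w ∘ toℕ)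
  ... | i , j , i<j , same = toℕ j , toℕ i , i<j , index-injective same

  first-revisit : ∃ λ j → Revisits j × (∀ {k} → k < j → ¬ Revisits k)
  first-revisit = least-witness revisits? (proj₂ revisit)

  -- At the first revisit w j ≡ w i the vertices w i, …, w (j-1) are distinct and
  -- w (i+2) ≢ w i, so the walk w (i+1), …, w j never crosses the edge {w i, w (i+1)}.
  edge-on-cycle : ∃₂ λ x y → R x y × Star (Without R x y) y x
  edge-on-cycle with first-revisit
  ... | j , (i , i<j , wi≡wj) , first =
    w i , w (suc i) , w-step i ,
    subst (Star (Without R (w i) (w (suc i))) (w (suc i))) (sym wi≡wj)
          (star-along w i<j λ {u} i<u u<j →
             w-step u , avoids-forward i<u u<j , avoids-backward i<u u<j)
    where
    avoids-forward : ∀ {u} → suc i ≤ u → u < j → ¬ (w u ≡ w i × w (suc u) ≡ w (suc i))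
    avoids-forward i<u u<j (wu≡wi , _) = first u<j (i , i<u , sym wu≡wi)

    avoids-backward : ∀ {u} → suc i ≤ u → u < j → ¬ (w u ≡ w (suc i) × w (suc u) ≡ w i)
    avoids-backward {u} i<u u<j (wu≡wi+1 , wu+1≡wi) with m≤n⇒m<n∨m≡n i<u
    ... | inj₁ i+1<u = first u<j (suc i , i+1<u , sym wu≡wi+1)
    ... | inj₂ refl  = w-no-backtrack i wu+1≡wi

NonBridge : Incidence v b → Set
NonBridge {v} {b} I =
  ∃₂ λ (p : Fin v) (B : Fin b) → I p B ≡ true × Star (Adj (deleteEdge I p B)) (inj₁ p) (inj₂ B)

Without-sym : {V : Set} {R : Rel V 0ℓ} {x y u u′ : V} → Without R x y u u′ → Without R y x u u′
Without-sym (r , ≢xy , ≢yx) = r , ≢yx , ≢xy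

without⇒deleteEdge : (I : Incidence v b) {p : Fin v} {B : Fin b} {u u′ : Vertex v b} →
                     Without (Adj I) (inj₁ p) (inj₂ B) u u′ → Adj (deleteEdge I p B) u u′
without⇒deleteEdge I {u = inj₁ _} {inj₂ _} (e , ≢pB , _) =
  trans (deleteEdge-other I λ { (refl , refl) → ≢pB (refl , refl) }) e
without⇒deleteEdge I {u = inj₂ _} {inj₁ _} (e , _ , ≢Bp) =
  trans (deleteEdge-other I λ { (refl , refl) → ≢Bp (refl , refl) }) e

on-cycle⇒NonBridge : (I : Incidence v b) (x y : Vertex v b) → Adj I x y →
                     Star (Without (Adj I) x y) y x → NonBridge I
on-cycle⇒NonBridge I (inj₁ p) (inj₂ B) e cycle =
  p , B , e , walk-reverse (deleteEdge I p B) (Star.map (without⇒deleteEdge I) cycle)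
on-cycle⇒NonBridge I (inj₂ B) (inj₁ p) e cycle =
  p , B , e , Star.map (without⇒deleteEdge I ∘ Without-sym {R = Adj I}) cycle

degree≥2⇒turn : (I : Incidence v b) → (∀ p → 2 ≤ count b (I p)) →
                   (∀ B → 2 ≤ count v (λ p → I p B)) →
                   ∀ {x y} → Adj I x y → ∃ λ z → Adj I y z × z ≢ x
degree≥2⇒turn {v} I _ col≥2 {inj₁ a} {inj₂ c} _ with count≥2⇒∃≢ v (col≥2 c) a
... | a′ , a′≢a , a′c = inj₁ a′ , a′c , a′≢a ∘ Sum.inj₁-injective
degree≥2⇒turn {b = b} I row≥2 _ {inj₂ c} {inj₁ a} _ with count≥2⇒∃≢ b (row≥2 a) c
... | c′ , c′≢c , ac′ = inj₂ c′ , ac′ , c′≢c ∘ Sum.inj₂-injective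

degree≥2⇒NonBridge : (I : Incidence v b) → (∀ p → 2 ≤ count b (I p)) →
                     (∀ B → 2 ≤ count v (λ p → I p B)) → Fin v → NonBridge I
degree≥2⇒NonBridge {v} {b} I row≥2 col≥2 p₀ =
  let B₀ , p₀B₀         = count>0⇒∃ b (≤-trans (s≤s z≤n) (row≥2 p₀))
      x , y , e , cycle = NonBacktrackingWalk.edge-on-cycle (join v b) (join-injective v b)
                            (Sum.≡-dec _≟_ _≟_) (Adj I) (degree≥2⇒turn I row≥2 col≥2)
                            {inj₁ p₀} {inj₂ B₀} p₀B₀
  in on-cycle⇒NonBridge I x y e cycle

module Glue {v₁ b₁ v₂ b₂ : ℕ} (I₁ : Incidence v₁ b₁) (I₂ : Incidence v₂ b₂)
  {p₁ : Fin v₁} {B₁ : Fin b₁} {p₂ : Fin v₂} {B₂ : Fin b₂}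
  (p₁B₁ : I₁ p₁ B₁ ≡ true) (p₂B₂ : I₂ p₂ B₂ ≡ true) where

  glued : Fin v₁ ⊎ Fin v₂ → Fin b₁ ⊎ Fin b₂ → Bool
  glued (inj₁ a) (inj₁ c) = deleteEdge I₁ p₁ B₁ a c
  glued (inj₂ a) (inj₂ c) = deleteEdge I₂ p₂ B₂ a c
  glued (inj₁ a) (inj₂ c) = edge p₁ B₂ a c
  glued (inj₂ a) (inj₁ c) = edge p₂ B₁ a c

  H : Incidence (v₁ + v₂) (b₁ + b₂)
  H p B = glued (splitAt v₁ p) (splitAt b₁ B)

  module _ {r k : ℕ}
    (row₁ : ∀ a → count b₁ (I₁ a) ≡ r) (col₁ : ∀ c → count v₁ (λ a → I₁ a c) ≡ k)
    (row₂ : ∀ a → count b₂ (I₂ a) ≡ r) (col₂ : ∀ c → count v₂ (λ a → I₂ a c) ≡ k) where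

    H-row : ∀ p → count (b₁ + b₂) (H p) ≡ r
    H-row p = trans (count-splitAt b₁ b₂ (glued (splitAt v₁ p))) (glued-row (splitAt v₁ p))
      where
      glued-row : ∀ P → count b₁ (glued P ∘ inj₁) + count b₂ (glued P ∘ inj₂) ≡ r
      glued-row (inj₁ a) = trans (row-after-swap I₁ B₂ p₁B₁ a) (row₁ a)
      glued-row (inj₂ a) = trans (+-comm (count b₁ (edge p₂ B₁ a)) _)
                                 (trans (row-after-swap I₂ B₁ p₂B₂ a) (row₂ a))

    H-column : ∀ B → count (v₁ + v₂) (λ p → H p B) ≡ k
    H-column B =
      trans (count-splitAt v₁ v₂ (λ P → glued P (splitAt b₁ B))) (glued-column (splitAt b₁ B))
      where
      glued-column : ∀ C → count v₁ (λ a → glued (inj₁ a) C) + count v₂ (λ a → glued (inj₂ a) C) ≡ k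
      glued-column (inj₁ c) = trans (column-after-swap I₁ p₂ p₁B₁ c) (col₁ c)
      glued-column (inj₂ c) = trans (+-comm (count v₁ (λ a → edge p₁ B₂ a c)) _)
                                    (trans (column-after-swap I₂ p₁ p₂B₂ c) (col₂ c))

  module _ (noC4₁ : NoC4 I₁) (noC4₂ : NoC4 I₂) where

    straddling : ∀ P P′ c c′ → P ≢ P′ → glued P (inj₁ c) ≡ true → glued P (inj₂ c′) ≡ true →
                 glued P′ (inj₁ c) ≡ true → glued P′ (inj₂ c′) ≡ true → ⊥
    straddling (inj₁ a) (inj₁ a′) c c′ P≢P′ _ h₂ _ h₄ =
      P≢P′ (cong inj₁ (trans (proj₁ (edge⇒≡ h₂)) (sym (proj₁ (edge⇒≡ h₄)))))
    straddling (inj₂ a) (inj₂ a′) c c′ P≢P′ h₁ _ h₃ _ =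
      P≢P′ (cong inj₂ (trans (proj₁ (edge⇒≡ h₁)) (sym (proj₁ (edge⇒≡ h₃)))))
    straddling (inj₁ a) (inj₂ a′) c c′ _ h₁ h₂ h₃ _ =
      deleteEdge-removes I₁ h₁ (proj₁ (edge⇒≡ h₂) , proj₂ (edge⇒≡ h₃))
    straddling (inj₂ a) (inj₁ a′) c c′ _ h₁ _ h₃ h₄ =
      deleteEdge-removes I₁ h₃ (proj₁ (edge⇒≡ h₄) , proj₂ (edge⇒≡ h₁))

    glued-noC4 : ∀ P P′ C C′ → P ≢ P′ → C ≢ C′ → glued P C ≡ true → glued P C′ ≡ true →
                 glued P′ C ≡ true → glued P′ C′ ≡ true → ⊥
    glued-noC4 P P′ (inj₁ c) (inj₂ c′) P≢P′ _ h₁ h₂ h₃ h₄ = straddling P P′ c c′ P≢P′ h₁ h₂ h₃ h₄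
    glued-noC4 P P′ (inj₂ c) (inj₁ c′) P≢P′ _ h₁ h₂ h₃ h₄ = straddling P P′ c′ c P≢P′ h₂ h₁ h₄ h₃
    glued-noC4 (inj₁ a) (inj₁ a′) (inj₁ c) (inj₁ c′) P≢P′ C≢C′ h₁ h₂ h₃ h₄ =
      noC4₁ a a′ c c′ (P≢P′ ∘ cong inj₁) (C≢C′ ∘ cong inj₁)
        (deleteEdge⊆ I₁ h₁) (deleteEdge⊆ I₁ h₂) (deleteEdge⊆ I₁ h₃) (deleteEdge⊆ I₁ h₄)
    glued-noC4 (inj₂ a) (inj₂ a′) (inj₂ c) (inj₂ c′) P≢P′ C≢C′ h₁ h₂ h₃ h₄ =
      noC4₂ a a′ c c′ (P≢P′ ∘ cong inj₂) (C≢C′ ∘ cong inj₂)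
        (deleteEdge⊆ I₂ h₁) (deleteEdge⊆ I₂ h₂) (deleteEdge⊆ I₂ h₃) (deleteEdge⊆ I₂ h₄)
    glued-noC4 (inj₂ a) _ (inj₁ c) (inj₁ c′) _ C≢C′ h₁ h₂ _ _ =
      C≢C′ (cong inj₁ (trans (proj₂ (edge⇒≡ h₁)) (sym (proj₂ (edge⇒≡ h₂)))))
    glued-noC4 (inj₁ a) (inj₂ a′) (inj₁ c) (inj₁ c′) _ C≢C′ _ _ h₃ h₄ =
      C≢C′ (cong inj₁ (trans (proj₂ (edge⇒≡ h₃)) (sym (proj₂ (edge⇒≡ h₄)))))
    glued-noC4 (inj₁ a) _ (inj₂ c) (inj₂ c′) _ C≢C′ h₁ h₂ _ _ =
      C≢C′ (cong inj₂ (trans (proj₂ (edge⇒≡ h₁)) (sym (proj₂ (edge⇒≡ h₂)))))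
    glued-noC4 (inj₂ a) (inj₁ a′) (inj₂ c) (inj₂ c′) _ C≢C′ _ _ h₃ h₄ =
      C≢C′ (cong inj₂ (trans (proj₂ (edge⇒≡ h₃)) (sym (proj₂ (edge⇒≡ h₄)))))

    H-noC4 : NoC4 H
    H-noC4 p p′ B B′ p≢p′ B≢B′ =
      glued-noC4 (splitAt v₁ p) (splitAt v₁ p′) (splitAt b₁ B) (splitAt b₁ B′)
      (p≢p′ ∘ splitAt-injective v₁) (B≢B′ ∘ splitAt-injective b₁)

  glued-adj : ∀ P C → glued P C ≡ true → Adj H (inj₁ (join v₁ v₂ P)) (inj₂ (join b₁ b₂ C))
  glued-adj P C = subst₂ (λ P′ C′ → glued P′ C′ ≡ true)
                         (sym (splitAt-join v₁ v₂ P)) (sym (splitAt-join b₁ b₂ C))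

  left : Vertex v₁ b₁ → Vertex (v₁ + v₂) (b₁ + b₂)
  left = Sum.map (join v₁ v₂ ∘ inj₁) (join b₁ b₂ ∘ inj₁)

  right : Vertex v₂ b₂ → Vertex (v₁ + v₂) (b₁ + b₂)
  right = Sum.map (join v₁ v₂ ∘ inj₂) (join b₁ b₂ ∘ inj₂)

  left-adj : ∀ {x y} → Adj (deleteEdge I₁ p₁ B₁) x y → Adj H (left x) (left y)
  left-adj {inj₁ a} {inj₂ c} e = glued-adj (inj₁ a) (inj₁ c) e
  left-adj {inj₂ c} {inj₁ a} e = glued-adj (inj₁ a) (inj₁ c) e

  right-adj : ∀ {x y} → Adj (deleteEdge I₂ p₂ B₂) x y → Adj H (right x) (right y)
  right-adj {inj₁ a} {inj₂ c} e = glued-adj (inj₂ a) (inj₂ c) e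
  right-adj {inj₂ c} {inj₁ a} e = glued-adj (inj₂ a) (inj₂ c) e

  module _ (bypass : Star (Adj (deleteEdge I₁ p₁ B₁)) (inj₁ p₁) (inj₂ B₁))
           (connected₁ : Connected I₁) (connected₂ : Connected I₂) where

    hub : Vertex (v₁ + v₂) (b₁ + b₂)
    hub = left (inj₁ p₁)

    p₂B₁ : Adj H (right (inj₁ p₂)) (left (inj₂ B₁))
    p₂B₁ = glued-adj (inj₂ p₂) (inj₁ B₁) (edge-self p₂ B₁)

    B₂p₁ : Adj H (right (inj₂ B₂)) hub
    B₂p₁ = glued-adj (inj₁ p₁) (inj₂ B₂) (edge-self p₁ B₂)

    B₁⇝hub : Star (Adj H) (left (inj₂ B₁)) hub
    B₁⇝hub = Star.gmap left left-adj (walk-reverse (deleteEdge I₁ p₁ B₁) bypass)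

    left⇝hub : ∀ x → Star (Adj H) (left x) hub
    left⇝hub x with deleteEdge-reaches-end I₁ p₁ B₁ (connected₁ x (inj₁ p₁))
    ... | inj₁ x⇝p₁ = Star.gmap left left-adj x⇝p₁
    ... | inj₂ x⇝B₁ = Star.gmap left left-adj x⇝B₁ ◅◅ B₁⇝hub

    right⇝hub : ∀ y → Star (Adj H) (right y) hub
    right⇝hub y with deleteEdge-reaches-end I₂ p₂ B₂ (connected₂ y (inj₁ p₂))
    ... | inj₁ y⇝p₂ = Star.gmap right right-adj y⇝p₂ ◅◅ p₂B₁ ◅ B₁⇝hub
    ... | inj₂ y⇝B₂ = Star.gmap right right-adj y⇝B₂ ◅◅ B₂p₁ ◅ ε

    ⇝hub : ∀ z → Star (Adj H) z hub
    ⇝hub (inj₁ p) =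
      subst (λ q → Star (Adj H) (inj₁ q) hub) (join-splitAt v₁ v₂ p) (point⇝hub (splitAt v₁ p))
      where
      point⇝hub : ∀ P → Star (Adj H) (inj₁ (join v₁ v₂ P)) hub
      point⇝hub (inj₁ a) = left⇝hub (inj₁ a)
      point⇝hub (inj₂ a) = right⇝hub (inj₁ a)
    ⇝hub (inj₂ B) =
      subst (λ q → Star (Adj H) (inj₂ q) hub) (join-splitAt b₁ b₂ B) (block⇝hub (splitAt b₁ B))
      where
      block⇝hub : ∀ C → Star (Adj H) (inj₂ (join b₁ b₂ C)) hub
      block⇝hub (inj₁ c) = left⇝hub (inj₂ c)
      block⇝hub (inj₂ c) = right⇝hub (inj₂ c)

    H-connected : Connected H
    H-connected x y = ⇝hub x ◅◅ walk-reverse H (⇝hub y)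

configurable-0 : ∀ {r k} → Configurable 0 0 r k
configurable-0 = (λ ()) , (λ { (inj₁ ()) ; (inj₂ ()) }) , (λ ()) , (λ ()) , (λ ())

no-points⇒no-blocks : ∀ {b k} (I : Incidence 0 b) → 0 < k →
                      (∀ B → count 0 (λ p → I p B) ≡ k) → b ≡ 0
no-points⇒no-blocks {zero}  I _   _   = refl
no-points⇒no-blocks {suc b} I 0<k col with col Fin.zero
no-points⇒no-blocks {suc b} I ()  col | refl

configurable-+ : ∀ {v₁ b₁ v₂ b₂ r k} → 2 ≤ r → 2 ≤ k →
                 Configurable v₁ b₁ r k → Configurable v₂ b₂ r k →
                 Configurable (v₁ + v₂) (b₁ + b₂) r k
configurable-+ {zero} _ 2≤k (I₁ , _ , _ , _ , col₁) C₂
  with refl ← no-points⇒no-blocks I₁ (≤-trans (s≤s z≤n) 2≤k) col₁ = C₂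
configurable-+ {suc _} {v₂ = zero} {r = r} {k} _ 2≤k C₁ (I₂ , _ , _ , _ , col₂)
  with refl ← no-points⇒no-blocks I₂ (≤-trans (s≤s z≤n) 2≤k) col₂ =
  subst₂ (λ v b → Configurable v b r k) (sym (+-identityʳ _)) (sym (+-identityʳ _)) C₁
configurable-+ {v₁@(suc _)} {b₁} {v₂@(suc _)} {b₂} {r} {k} 2≤r 2≤k
  (I₁ , connected₁ , noC4₁ , row₁ , col₁) (I₂ , connected₂ , noC4₂ , row₂ , col₂) =
  glue (degree≥2⇒NonBridge I₁ (λ p → subst (2 ≤_) (sym (row₁ p)) 2≤r)
                             (λ B → subst (2 ≤_) (sym (col₁ B)) 2≤k) Fin.zero)
       (count>0⇒∃ b₂ (subst (0 <_) (sym (row₂ Fin.zero)) (≤-trans (s≤s z≤n) 2≤r)))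
  where
  glue : NonBridge I₁ → ∃ (λ B → I₂ Fin.zero B ≡ true) → Configurable (v₁ + v₂) (b₁ + b₂) r k
  glue (p₁ , B₁ , p₁B₁ , bypass) (B₂ , p₂B₂) =
    H , H-connected bypass connected₁ connected₂ , H-noC4 noC4₁ noC4₂ ,
    H-row row₁ col₁ row₂ col₂ , H-column row₁ col₁ row₂ col₂
    where open Glue I₁ I₂ p₁B₁ p₂B₂

lemma8 : (r k : ℕ) → 3 ≤ r → 3 ≤ k →
    InD r k 0 × ((d d' : ℕ) → InD r k d → InD r k d' → InD r k (d + d'))
lemma8 r k 3≤r 3≤k = configurable-0 , λ d d′ C C′ →
  subst₂ (λ v b → Configurable v b r k)
    (sym (*-distribʳ-+ (k div gcd r k) d d′)) (sym (*-distribʳ-+ (r div gcd r k) d d′))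
    (configurable-+ (≤-trans (n≤1+n 2) 3≤r) (≤-trans (n≤1+n 2) 3≤k) C C′)
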